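{- The formula $\Box(p\vee q)\to((\neg\Box\neg p\to\Box q)\to\Box q)$ is derivable in $\mathsf{CK}\oplus N_\Diamond\oplus\mathsf{wCD}$ but not in $\mathsf{CK}$.
   Context: Formulas are built from a countably infinite set of propositional variables by $\varphi ::= p \mid \bot \mid \varphi\wedge\varphi \mid \varphi\vee\varphi \mid \varphi\to\varphi \mid \Box\varphi \mid \Diamond\varphi$; $\neg\varphi:=\varphi\to\bot$. For a set $\mathsf{Ax}$ of formulas, $\mathsf{CK}\oplus\mathsf{Ax}$ is the logic whose derivable formulas are generated by: substitution instances of axioms of a standard Hilbert axiomatisation of intuitionistic propositional logic, of $\Box(p\to q)\to(\Box p\to\Box q)$, of $\Box(p\to q)\to(\Diamond p\to\Diamond q)$, and of formulas in $\mathsf{Ax}$; modus ponens; necessitation (from $\varphi$ infer $\Box\varphi$). $\mathsf{CK}=\mathsf{CK}\oplus\emptyset$; $\mathsf{CK}\oplus A_1\oplus A_2$ denotes $\mathsf{CK}\oplus\{A_1,A_2\}$. Axioms: $N_\Diamond$: $\Diamond\bot\to\bot$; $\mathsf{wCD}$: $\Box(p\vee q)\to((\Diamond p\to\Box q)\to\Box q)$. -}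

module Defs where

open import Data.Nat using (ℕ)
open import Relation.Nullary using (¬_)

data Fm : Set where
  var  : ℕ → Fm
  ⊥'   : Fm
  _∧'_ : Fm → Fm → Fm
  _∨'_ : Fm → Fm → Fm
  _⇒_  : Fm → Fm → Fm
  □_   : Fm → Fm
  ◇_   : Fm → Fm

infixr 5 _⇒_
infixr 6 _∨'_
infixr 7 _∧'_
infix 8 □_ ◇_

∼_ : Fm → Fm
∼ φ = φ ⇒ ⊥'

infix 8 ∼_

Subst : Set
Subst = ℕ → Fm

_[_] : Fm → Subst → Fm
var n [ σ ] = σ n
⊥' [ σ ] = ⊥'
(φ ∧' ψ) [ σ ] = (φ [ σ ]) ∧' (ψ [ σ ])
(φ ∨' ψ) [ σ ] = (φ [ σ ]) ∨' (ψ [ σ ])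
(φ ⇒ ψ) [ σ ] = (φ [ σ ]) ⇒ (ψ [ σ ])
(□ φ) [ σ ] = □ (φ [ σ ])
(◇ φ) [ σ ] = ◇ (φ [ σ ])

p q r : Fm
p = var 0
q = var 1
r = var 2

-- Base axioms: a standard Hilbert axiomatisation of intuitionistic
-- propositional logic, plus the two CK axioms K□ and K◇.
data BaseAx : Fm → Set where
  ax-K     : BaseAx (p ⇒ (q ⇒ p))
  ax-S     : BaseAx ((p ⇒ (q ⇒ r)) ⇒ ((p ⇒ q) ⇒ (p ⇒ r)))
  ax-∧E₁   : BaseAx ((p ∧' q) ⇒ p)
  ax-∧E₂   : BaseAx ((p ∧' q) ⇒ q)
  ax-∧I    : BaseAx (p ⇒ (q ⇒ (p ∧' q)))
  ax-∨I₁   : BaseAx (p ⇒ (p ∨' q))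
  ax-∨I₂   : BaseAx (q ⇒ (p ∨' q))
  ax-∨E    : BaseAx ((p ⇒ r) ⇒ ((q ⇒ r) ⇒ ((p ∨' q) ⇒ r)))
  ax-efq   : BaseAx (⊥' ⇒ p)
  ax-K□    : BaseAx (□ (p ⇒ q) ⇒ (□ p ⇒ □ q))
  ax-K◇    : BaseAx (□ (p ⇒ q) ⇒ (◇ p ⇒ ◇ q))

-- Derivability in CK ⊕ Ax, where Ax is a predicate on formulas
data _⊢_ (Ax : Fm → Set) : Fm → Set where
  base  : ∀ {φ} (σ : Subst) → BaseAx φ → Ax ⊢ (φ [ σ ])
  extra : ∀ {φ} (σ : Subst) → Ax φ → Ax ⊢ (φ [ σ ])
  mp    : ∀ {φ ψ} → Ax ⊢ (φ ⇒ ψ) → Ax ⊢ φ → Ax ⊢ ψ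
  nec   : ∀ {φ} → Ax ⊢ φ → Ax ⊢ (□ φ)

infix 3 _⊢_

data NoAx : Fm → Set where

data N◇-wCD : Fm → Set where
  N◇  : N◇-wCD (◇ ⊥' ⇒ ⊥')
  wCD : N◇-wCD (□ (p ∨' q) ⇒ ((◇ p ⇒ □ q) ⇒ □ q))

target : Fm
target = □ (p ∨' q) ⇒ ((∼ (□ (∼ p)) ⇒ □ q) ⇒ □ q)

-- Derivability: K◇ turns □¬p into ◇p → ◇⊥, which N◇ refutes, so ◇p → ¬□¬p; weakening the
-- antecedent ◇p → □q of wCD to ¬□¬p → □q gives the formula.
-- Underivability: take the three-element Heyting chain 0 < ½ < 1 with □x = 1 for x = 1 and
-- □x = ½ otherwise, and ◇ constantly 0.  All CK axioms take the value 1 and the rules preserve 1,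
-- but p = 1, q = 0 gives □(p ∨ q) = 1, ¬□¬p = ¬½ = 0 and □q = ½, so the formula has value ½.
module Submission where

open import Defs
open import Data.Nat using (ℕ; zero; suc)
open import Data.Product using (_×_; _,_)
open import Relation.Nullary using (¬_; Dec; yes; no)
open import Relation.Nullary.Decidable using (True; toWitness; map′; _×-dec_)
open import Relation.Unary using (Decidable)
open import Relation.Binary.PropositionalEquality using (_≡_; refl; trans; cong; cong₂)

variable
  Ax : Fm → Set
  φ ψ χ : Fm

assign₃ : {A : Set} → A → A → A → ℕ → A
assign₃ a b c zero          = a
assign₃ a b c (suc zero)    = b
assign₃ a b c (suc (suc _)) = c

module Hilbert {Ax : Fm → Set} where

  K-instance : ∀ φ ψ → Ax ⊢ φ ⇒ ψ ⇒ φ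
  K-instance φ ψ = base (assign₃ φ ψ ⊥') ax-K

  S-instance : ∀ φ ψ χ → Ax ⊢ (φ ⇒ ψ ⇒ χ) ⇒ (φ ⇒ ψ) ⇒ φ ⇒ χ
  S-instance φ ψ χ = base (assign₃ φ ψ χ) ax-S

  ⇒-refl : Ax ⊢ φ ⇒ φ
  ⇒-refl {φ} = mp (mp (S-instance φ (φ ⇒ φ) φ) (K-instance φ (φ ⇒ φ))) (K-instance φ φ)

  ⇒-monoʳ : Ax ⊢ ψ ⇒ χ → Ax ⊢ (φ ⇒ ψ) ⇒ φ ⇒ χ
  ⇒-monoʳ {ψ} {χ} {φ} ψ⇒χ = mp (S-instance φ ψ χ) (mp (K-instance (ψ ⇒ χ) φ) ψ⇒χ)

  ⇒-trans : Ax ⊢ φ ⇒ ψ → Ax ⊢ ψ ⇒ χ → Ax ⊢ φ ⇒ χ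
  ⇒-trans φ⇒ψ ψ⇒χ = mp (⇒-monoʳ ψ⇒χ) φ⇒ψ

  ⇒-swap : Ax ⊢ φ ⇒ ψ ⇒ χ → Ax ⊢ ψ ⇒ φ ⇒ χ
  ⇒-swap {φ} {ψ} {χ} φ⇒ψ⇒χ = ⇒-trans (K-instance ψ φ) (mp (S-instance φ ψ χ) φ⇒ψ⇒χ)

  ⇒-antimonoˡ : Ax ⊢ φ ⇒ ψ → Ax ⊢ (ψ ⇒ χ) ⇒ φ ⇒ χ
  ⇒-antimonoˡ φ⇒ψ = ⇒-swap (⇒-trans φ⇒ψ (⇒-swap ⇒-refl))

open Hilbert

◇⇒∼□∼ : Ax ⊢ ◇ ⊥' ⇒ ⊥' → ∀ φ → Ax ⊢ ◇ φ ⇒ ∼ □ ∼ φ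
◇⇒∼□∼ N◇-derivable φ =
  ⇒-swap (⇒-trans (base (assign₃ φ ⊥' ⊥') ax-K◇) (⇒-monoʳ N◇-derivable))

target-derivable : N◇-wCD ⊢ target
target-derivable =
  ⇒-trans (extra var wCD) (⇒-antimonoˡ (⇒-antimonoˡ (◇⇒∼□∼ (extra var N◇) p)))

record Interpretation : Set₁ where
  field
    Carrier     : Set
    ⊤ ⊥         : Carrier
    _⊓_ _⊔_ _⇨_ : Carrier → Carrier → Carrier
    ■ ◆         : Carrier → Carrier

module Semantics (𝔸 : Interpretation) where
  open Interpretation 𝔸

  ⟦_⟧ : Fm → (ℕ → Carrier) → Carrier
  ⟦ var n ⟧  v = v n
  ⟦ ⊥' ⟧     v = ⊥
  ⟦ φ ∧' ψ ⟧ v = ⟦ φ ⟧ v ⊓ ⟦ ψ ⟧ v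
  ⟦ φ ∨' ψ ⟧ v = ⟦ φ ⟧ v ⊔ ⟦ ψ ⟧ v
  ⟦ φ ⇒ ψ ⟧  v = ⟦ φ ⟧ v ⇨ ⟦ ψ ⟧ v
  ⟦ □ φ ⟧    v = ■ (⟦ φ ⟧ v)
  ⟦ ◇ φ ⟧    v = ◆ (⟦ φ ⟧ v)

  Valid : Fm → Set
  Valid φ = ∀ v → ⟦ φ ⟧ v ≡ ⊤

  ⟦⟧-subst : ∀ φ σ v → ⟦ φ [ σ ] ⟧ v ≡ ⟦ φ ⟧ (λ n → ⟦ σ n ⟧ v)
  ⟦⟧-subst (var n)  σ v = refl
  ⟦⟧-subst ⊥'       σ v = refl
  ⟦⟧-subst (φ ∧' ψ) σ v = cong₂ _⊓_ (⟦⟧-subst φ σ v) (⟦⟧-subst ψ σ v)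
  ⟦⟧-subst (φ ∨' ψ) σ v = cong₂ _⊔_ (⟦⟧-subst φ σ v) (⟦⟧-subst ψ σ v)
  ⟦⟧-subst (φ ⇒ ψ)  σ v = cong₂ _⇨_ (⟦⟧-subst φ σ v) (⟦⟧-subst ψ σ v)
  ⟦⟧-subst (□ φ)    σ v = cong ■ (⟦⟧-subst φ σ v)
  ⟦⟧-subst (◇ φ)    σ v = cong ◆ (⟦⟧-subst φ σ v)

  Valid-subst : ∀ φ → Valid φ → ∀ σ → Valid (φ [ σ ])
  Valid-subst φ valid σ v = trans (⟦⟧-subst φ σ v) (valid _)

  soundness : (∀ {φ} → BaseAx φ → Valid φ) →
              (∀ {φ} → Ax φ → Valid φ) →
              (∀ {x y} → x ⇨ y ≡ ⊤ → x ≡ ⊤ → y ≡ ⊤) →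
              ■ ⊤ ≡ ⊤ →
              Ax ⊢ φ → Valid φ
  soundness {Ax} base-valid ax-valid ⇨-detach ■⊤≡⊤ = sound
    where
    sound : ∀ {φ} → Ax ⊢ φ → Valid φ
    sound (base {φ} σ a)  = Valid-subst φ (base-valid a) σ
    sound (extra {φ} σ a) = Valid-subst φ (ax-valid a) σ
    sound (mp d e) v      = ⇨-detach (sound d v) (sound e v)
    sound (nec d) v       = trans (cong ■ (sound d v)) ■⊤≡⊤

data Chain₃ : Set where
  bot mid top : Chain₃

_⊓₃_ : Chain₃ → Chain₃ → Chain₃
bot ⊓₃ _   = bot
mid ⊓₃ bot = bot
mid ⊓₃ _   = mid
top ⊓₃ y   = y

_⊔₃_ : Chain₃ → Chain₃ → Chain₃
bot ⊔₃ y   = y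
mid ⊔₃ top = top
mid ⊔₃ _   = mid
top ⊔₃ _   = top

_⇨₃_ : Chain₃ → Chain₃ → Chain₃
bot ⇨₃ _   = top
mid ⇨₃ bot = bot
mid ⇨₃ _   = top
top ⇨₃ y   = y

■₃ : Chain₃ → Chain₃
■₃ top = top
■₃ _   = mid

chain₃ : Interpretation
chain₃ = record
  { Carrier = Chain₃ ; ⊤ = top ; ⊥ = bot
  ; _⊓_ = _⊓₃_ ; _⊔_ = _⊔₃_ ; _⇨_ = _⇨₃_
  ; ■ = ■₃ ; ◆ = λ _ → bot
  }

open Semantics chain₃

∀-Chain₃? : {P : Chain₃ → Set} → Decidable P → Dec (∀ x → P x)
∀-Chain₃? P? = map′ (λ { (b , m , t) → λ { bot → b ; mid → m ; top → t } })
                    (λ all → all bot , all mid , all top)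
                    (P? bot ×-dec P? mid ×-dec P? top)

≡top? : ∀ x → Dec (x ≡ top)
≡top? bot = no λ ()
≡top? mid = no λ ()
≡top? top = yes refl

valid₃? : ∀ φ → Dec (∀ a b c → ⟦ φ ⟧ (assign₃ a b c) ≡ top)
valid₃? φ = ∀-Chain₃? λ a → ∀-Chain₃? λ b → ∀-Chain₃? λ c → ≡top? (⟦ φ ⟧ (assign₃ a b c))

valid₃-by-enumeration : ∀ φ → {True (valid₃? φ)} → ∀ a b c → ⟦ φ ⟧ (assign₃ a b c) ≡ top
valid₃-by-enumeration φ {checked} = toWitness checked

-- Each axiom mentions only p, q, r, so ⟦ φ ⟧ v computes to the same term as
-- ⟦ φ ⟧ (assign₃ (v 0) (v 1) (v 2)).
chain₃-validates-BaseAx : BaseAx φ → Valid φ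
chain₃-validates-BaseAx {φ} ax-K   v = valid₃-by-enumeration φ (v 0) (v 1) (v 2)
chain₃-validates-BaseAx {φ} ax-S   v = valid₃-by-enumeration φ (v 0) (v 1) (v 2)
chain₃-validates-BaseAx {φ} ax-∧E₁ v = valid₃-by-enumeration φ (v 0) (v 1) (v 2)
chain₃-validates-BaseAx {φ} ax-∧E₂ v = valid₃-by-enumeration φ (v 0) (v 1) (v 2)
chain₃-validates-BaseAx {φ} ax-∧I  v = valid₃-by-enumeration φ (v 0) (v 1) (v 2)
chain₃-validates-BaseAx {φ} ax-∨I₁ v = valid₃-by-enumeration φ (v 0) (v 1) (v 2)
chain₃-validates-BaseAx {φ} ax-∨I₂ v = valid₃-by-enumeration φ (v 0) (v 1) (v 2)
chain₃-validates-BaseAx {φ} ax-∨E  v = valid₃-by-enumeration φ (v 0) (v 1) (v 2)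
chain₃-validates-BaseAx {φ} ax-efq v = valid₃-by-enumeration φ (v 0) (v 1) (v 2)
chain₃-validates-BaseAx {φ} ax-K□  v = valid₃-by-enumeration φ (v 0) (v 1) (v 2)
chain₃-validates-BaseAx {φ} ax-K◇  v = valid₃-by-enumeration φ (v 0) (v 1) (v 2)

top⇨₃-detach : ∀ {x y} → x ⇨₃ y ≡ top → x ≡ top → y ≡ top
top⇨₃-detach x⇨y≡top refl = x⇨y≡top

CK-sound-in-chain₃ : NoAx ⊢ φ → Valid φ
CK-sound-in-chain₃ = soundness chain₃-validates-BaseAx (λ ()) top⇨₃-detach refl

target-not-CK : ¬ (NoAx ⊢ target)
target-not-CK ⊢target with CK-sound-in-chain₃ ⊢target (assign₃ top bot bot)
... | ()

mainTheorem20 : (N◇-wCD ⊢ target) × (¬ (NoAx ⊢ target))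
mainTheorem20 = target-derivable , target-not-CK
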